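{- Suppose $C,D$ are two different connected components of the social graph $M$, and there is a solitary path in $H$ that starts in a vertex of $U_C$ and ends in a vertex of $U_D$. Then, for each $s\in [n]$, there is a solitary path that starts in a vertex of $U_C$, ends in a vertex of $U_D$, and whose all vertices belong to the block $G_s$.
   Context: Fix $k$ and $k$-derivations $\sigma_1,\ldots,\sigma_n$ (triples of a $k$-colored graph, a profile function $V\to 2^{[k]}$ and a recoloring $[k]\to[k]$, composed as in the paper) that all have the same abstraction $e=(L,\rho,\phi)$, idempotent in the semigroup of abstractions; here the abstraction of $\sigma$ consists of the set $L$ of cells $c\in[k]\times2^{[k]}$ with $\sigma[c]\ne\emptyset$ ($\sigma[c]$ = vertices of color $i$ and profile $X$ for $c=(i,X)$), the set $\rho$ of tuples $(Z,c,d,W)$ such that in the $Z$-flip of $\sigma$ (adjacency reversed between $\sigma[c']$ and $\sigma[d']$ for $\{c',d'\}\in Z$) a path runs from $\sigma[c]$ to $\sigma[d]$ with internal vertices in $\bigcup_{b\in W}\sigma[b]$, and the recoloring $\phi$ (which is then idempotent). Let $\sigma=\sigma_1\cdots\sigma_n$ with underlying graph $G$, and let $G_s$ (the $s$-th block) be the underlying graph of $\sigma_s$. Let $U_c=\bigcup_s\sigma_s[c]$. Cells in $L$ are essential. A pair of cells $c=(i,X)$, $d=(j,Y)$ is positive if $\phi(j)\in X$ and $\phi(i)\in Y$, negative if neither holds, mixed if exactly one holds. An essential cell is social if it forms a mixed pair with some essential cell, otherwise solitary; a vertex is social/solitary if it lies in $U_c$ for a social/solitary cell. The social graph $M$ has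 the social cells as vertices, adjacent iff they form a mixed pair; for a component $C$ of $M$, $U_C=\bigcup_{c\in C}U_c$. $H$ is obtained from $G$ by flipping adjacency between $U_c$ and $U_d$ for every positive pair of essential cells $(c,d)$ (including $c=d$); $H$ equals the $Z$-flip of $\sigma$ for $Z$ the set of positive pairs. A path in $H$ is solitary if all its internal vertices are solitary and, if its endpoints lie in $U_c$ and $U_d$, then $(c,d)$ is not mixed. -}

module Defs where

open import Data.Nat using (ℕ; zero; suc; _+_)
open import Data.Fin using (Fin; zero; suc; splitAt)
open import Data.Fin.Subset using (Subset)
open import Data.Vec using (lookup)
open import Data.Bool using (Bool; true; false; T; _∧_; _∨_; _xor_; not)
open import Data.Product using (Σ; _×_; _,_; ∃)
open import Data.Sum using (_⊎_; inj₁; inj₂)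
open import Data.Empty using (⊥)
open import Data.List using (List; []; _∷_)
open import Data.List.Relation.Unary.All using (All)
open import Data.List.Relation.Unary.Unique.Propositional using (Unique)
open import Relation.Binary.PropositionalEquality using (_≡_)
open import Relation.Nullary using (¬_)
open import Function using (id; _∘_)
open import Function.Bundles using (_⇔_)

module _ {V : Set} (E : V → V → Set) where

  data Walk : V → V → Set where
    here  : ∀ {x} → Walk x x
    there : ∀ {x y z} → E x y → Walk y z → Walk x z

  verts : ∀ {x y} → Walk x y → List V
  verts {x} here          = x ∷ []
  verts {x} (there e w)   = x ∷ verts w

  inner : ∀ {x y} → Walk x y → List V
  inner here                              = []
  inner (there e here)                    = []
  inner (there {y = y} e (there e' w))    = y ∷ inner (there e' w)

  IsPath : ∀ {x y} → Walk x y → Set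
  IsPath w = Unique (verts w)

-- k-derivations: a k-coloured (finite) graph, a profile function
-- V → 2^[k] and a recolouring [k] → [k].  Vertices are Fin size.

record Deriv (k : ℕ) : Set where
  field
    size : ℕ
    adj  : Fin size → Fin size → Bool
    col  : Fin size → Fin k
    prof : Fin size → Subset k
    rec  : Fin k → Fin k
open Deriv public

IsGraph : ∀ {k} → Deriv k → Set
IsGraph σ = (∀ u v → adj σ u v ≡ adj σ v u) × (∀ u → adj σ u u ≡ false)

Cell : ℕ → Set
Cell k = Fin k × Subset k

cellOf : ∀ {k} (σ : Deriv k) → Fin (size σ) → Cell k
cellOf σ x = col σ x , prof σ x

-- Composition σ · τ (σ first, τ added afterwards):
--  * disjoint union of the graphs (vertices of σ first);
--  * a vertex v of τ and a vertex u of σ are adjacent iff the colour of u,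
--    recoloured by the recolouring of τ, belongs to the profile of v;
--  * vertices of σ get recoloured by rec τ, vertices of τ keep their colour;
--  * profiles are inherited; the recolouring is rec τ ∘ rec σ.
crossAdj : ∀ {k} (σ τ : Deriv k) → Fin (size σ) → Fin (size τ) → Bool
crossAdj σ τ u v = lookup (prof τ v) (rec τ (col σ u))

compAdj : ∀ {k} (σ τ : Deriv k) → Fin (size σ + size τ) → Fin (size σ + size τ) → Bool
compAdj σ τ x y with splitAt (size σ) x | splitAt (size σ) y
... | inj₁ u | inj₁ u' = adj σ u u'
... | inj₂ v | inj₂ v' = adj τ v v'
... | inj₁ u | inj₂ v  = crossAdj σ τ u v
... | inj₂ v | inj₁ u  = crossAdj σ τ u v

compCol : ∀ {k} (σ τ : Deriv k) → Fin (size σ + size τ) → Fin k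
compCol σ τ x with splitAt (size σ) x
... | inj₁ u = rec τ (col σ u)
... | inj₂ v = col τ v

compProf : ∀ {k} (σ τ : Deriv k) → Fin (size σ + size τ) → Subset k
compProf σ τ x with splitAt (size σ) x
... | inj₁ u = prof σ u
... | inj₂ v = prof τ v

_·_ : ∀ {k} → Deriv k → Deriv k → Deriv k
σ · τ = record
  { size = size σ + size τ
  ; adj  = compAdj σ τ
  ; col  = compCol σ τ
  ; prof = compProf σ τ
  ; rec  = rec τ ∘ rec σ
  }

ε : ∀ {k} → Deriv k
ε = record { size = 0 ; adj = λ () ; col = λ () ; prof = λ () ; rec = id }

prod : ∀ {k} (n : ℕ) → (Fin n → Deriv k) → Deriv k
prod zero    σ = ε
prod (suc n) σ = σ zero · prod n (σ ∘ suc)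

blockOf : ∀ {k} (n : ℕ) (σ : Fin n → Deriv k) → Fin (size (prod n σ)) → Fin n
blockOf zero    σ ()
blockOf (suc n) σ x with splitAt (size (σ zero)) x
... | inj₁ u = zero
... | inj₂ v = suc (blockOf n (σ ∘ suc) v)

-- the cell of a vertex of σ₁⋯σₙ inside its own block σ_s
-- (so x ∈ U_c iff localCell x ≡ c)
localCell : ∀ {k} (n : ℕ) (σ : Fin n → Deriv k) → Fin (size (prod n σ)) → Cell k
localCell zero    σ ()
localCell (suc n) σ x with splitAt (size (σ zero)) x
... | inj₁ u = cellOf (σ zero) u
... | inj₂ v = localCell n (σ ∘ suc) v

-- the Z-flip of σ; Z is a set of unordered pairs of cells, given by a
-- Boolean relation whose symmetric closure is the set of pairs
-- (pairs {c,c} allowed)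
ZFlipAdj : ∀ {k} (σ : Deriv k) → (Cell k → Cell k → Bool) → Fin (size σ) → Fin (size σ) → Set
ZFlipAdj σ Z u v = T (adj σ u v xor (Z (cellOf σ u) (cellOf σ v) ∨ Z (cellOf σ v) (cellOf σ u)))

NonemptyCell : ∀ {k} (σ : Deriv k) → Cell k → Set
NonemptyCell σ c = Σ (Fin (size σ)) λ x → cellOf σ x ≡ c

RhoTuple : ∀ {k} (σ : Deriv k) → (Cell k → Cell k → Bool) → Cell k → Cell k → (Cell k → Bool) → Set
RhoTuple σ Z c d W =
  Σ (Fin (size σ)) λ x → Σ (Fin (size σ)) λ y →
    cellOf σ x ≡ c × cellOf σ y ≡ d ×
    Σ (Walk (ZFlipAdj σ Z) x y) λ p →
      IsPath (ZFlipAdj σ Z) p × All (λ v → T (W (cellOf σ v))) (inner (ZFlipAdj σ Z) p)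

record Abstraction (k : ℕ) : Set₁ where
  field
    L   : Cell k → Set
    ρ   : (Cell k → Cell k → Bool) → Cell k → Cell k → (Cell k → Bool) → Set
    φ   : Fin k → Fin k
open Abstraction public

HasAbstraction : ∀ {k} → Deriv k → Abstraction k → Set
HasAbstraction σ e =
  (∀ c → L e c ⇔ NonemptyCell σ c) ×
  (∀ Z c d W → ρ e Z c d W ⇔ RhoTuple σ Z c d W) ×
  (∀ i → φ e i ≡ rec σ i)

-- e is idempotent in the semigroup of abstractions: the product e·e,
-- i.e. the abstraction of σ·τ for any derivations σ, τ with abstraction e,
-- is again e.
Idempotent : ∀ {k} → Abstraction k → Set
Idempotent e = ∀ σ τ → IsGraph σ → IsGraph τ →
  HasAbstraction σ e → HasAbstraction τ e → HasAbstraction (σ · τ) e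

module _ {k : ℕ} (e : Abstraction k) where

  sees : Cell k → Cell k → Bool
  sees (i , X) (j , Y) = lookup X (φ e j)

  Positive : Cell k → Cell k → Set
  Positive c d = T (sees c d ∧ sees d c)

  Mixed : Cell k → Cell k → Set
  Mixed c d = T (sees c d xor sees d c)

  Essential : Cell k → Set
  Essential c = L e c

  Social : Cell k → Set
  Social c = Essential c × Σ (Cell k) λ d → Essential d × Mixed c d

  Solitary : Cell k → Set
  Solitary c = Essential c × ¬ (Σ (Cell k) λ d → Essential d × Mixed c d)

  MAdj : Cell k → Cell k → Set
  MAdj c d = Social c × Social d × Mixed c d

  SameComponent : Cell k → Cell k → Set
  SameComponent c d = Walk MAdj c d

  -- x ∈ U_C where C is the component of M containing the social cell c₀
  InUComp : ∀ (n : ℕ) (σ : Fin n → Deriv k) → Cell k → Fin (size (prod n σ)) → Set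
  InUComp n σ c₀ x = Social (localCell n σ x) × SameComponent c₀ (localCell n σ x)

  -- adjacency in H: G with adjacency flipped between U_c and U_d for every
  -- positive pair of essential cells
  FlipPair : ∀ (n : ℕ) (σ : Fin n → Deriv k) → Fin (size (prod n σ)) → Fin (size (prod n σ)) → Set
  FlipPair n σ x y =
    Essential (localCell n σ x) × Essential (localCell n σ y) ×
    Positive (localCell n σ x) (localCell n σ y)

  HAdj : ∀ (n : ℕ) (σ : Fin n → Deriv k) → Fin (size (prod n σ)) → Fin (size (prod n σ)) → Set
  HAdj n σ x y =
    (FlipPair n σ x y × ¬ T (adj (prod n σ) x y)) ⊎
    (¬ FlipPair n σ x y × T (adj (prod n σ) x y))

  SolitaryVertex : ∀ (n : ℕ) (σ : Fin n → Deriv k) → Fin (size (prod n σ)) → Set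
  SolitaryVertex n σ x = Solitary (localCell n σ x)

  SolitaryPath : ∀ (n : ℕ) (σ : Fin n → Deriv k) {x y : Fin (size (prod n σ))} →
                 Walk (HAdj n σ) x y → Set
  SolitaryPath n σ {x} {y} p =
    IsPath (HAdj n σ) p ×
    All (SolitaryVertex n σ) (inner (HAdj n σ) p) ×
    ¬ Mixed (localCell n σ x) (localCell n σ y)

module Submission where

-- Let Z be the set of positive pairs of cells and W the
-- set of cells that form no mixed pair with an essential cell.  Then
--   (1) H is exactly the Z-flip of σ = σ₁⋯σₙ, and a solitary path in H is a
--       path in this Z-flip whose internal vertices have cells in W;
--   (2) σ embeds into the product σ₁·(σ₂·(⋯·σₙ)) without the trailing neutral
--       element, and this product has abstraction e because e is idempotent;
--       so the abstraction e records a ρ-tuple (Z,c,d,W) for cells c, d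
--       equivalent to those of the endpoints;
--   (3) since σ_s also has abstraction e, the same ρ-tuple is realised by a
--       path in the Z-flip of σ_s, and embedding the block σ_s back into σ
--       turns it into a solitary path of H inside the block G_s.
-- Cells of a vertex inside its block and inside σ differ by a recolouring,
-- which is invisible to Z, W, mixedness and the components of M because φ is
-- idempotent; this is captured by an equivalence _∼_ of cells.

open import Defs
open import Data.Nat using (ℕ; zero; suc; _+_)
open import Data.Fin using (Fin; zero; suc; splitAt; join; _↑ˡ_; _↑ʳ_)
open import Data.Fin.Properties using (splitAt-↑ˡ; splitAt-↑ʳ; ↑ˡ-injective; ↑ʳ-injective; join-splitAt; any?)
open import Data.Vec using (lookup)
open import Data.Bool using (Bool; true; false; T; _∧_; _∨_; _xor_)
open import Data.Bool.Properties using (∧-comm; ∨-idem; xor-comm)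
open import Data.Product using (Σ; _×_; _,_; proj₁; proj₂)
open import Data.Sum using (_⊎_; inj₁; inj₂; map₂)
open import Data.Sum.Properties using (inj₁-injective; inj₂-injective)
open import Data.Unit using (tt)
open import Data.List using (_∷_; map)
open import Data.List.Relation.Unary.All using (All; []; _∷_)
open import Data.List.Relation.Unary.Unique.Propositional using (Unique)
import Data.List.Relation.Unary.Unique.Propositional.Properties as Unique
open import Relation.Binary.PropositionalEquality
open import Relation.Nullary using (¬_; ¬?)
open import Relation.Nullary.Decidable using (⌊_⌋; T?; toWitness; fromWitness)
open import Function using (_∘_)
open import Function.Bundles using (_⇔_; mk⇔; Equivalence)

module _ {V V' : Set} {E : V → V → Set} {E' : V' → V' → Set}
         (f : V → V') (f-edge : ∀ {x y} → E x y → E' (f x) (f y)) where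

  mapWalk : ∀ {x y} → Walk E x y → Walk E' (f x) (f y)
  mapWalk here        = here
  mapWalk (there a w) = there (f-edge a) (mapWalk w)

  verts-mapWalk : ∀ {x y} (w : Walk E x y) → verts E' (mapWalk w) ≡ map f (verts E w)
  verts-mapWalk here        = refl
  verts-mapWalk (there a w) = cong (f _ ∷_) (verts-mapWalk w)

  mapWalk-isPath : (∀ {x y} → f x ≡ f y → x ≡ y) →
                   ∀ {x y} {w : Walk E x y} → IsPath E w → IsPath E' (mapWalk w)
  mapWalk-isPath f-injective {w = w} unique =
    subst Unique (sym (verts-mapWalk w)) (Unique.map⁺ f-injective unique)

  mapWalk-inner : {P : V → Set} {P' : V' → Set} → (∀ {v} → P v → P' (f v)) →
                  ∀ {x y} (w : Walk E x y) → All P (inner E w) → All P' (inner E' (mapWalk w))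
  mapWalk-inner h here                  []       = []
  mapWalk-inner h (there a here)        []       = []
  mapWalk-inner h (there a (there b w)) (pv ∷ ps) = h pv ∷ mapWalk-inner h (there b w) ps

  mapWalk-verts : {P' : V' → Set} → (∀ v → P' (f v)) →
                  ∀ {x y} (w : Walk E x y) → All P' (verts E' (mapWalk w))
  mapWalk-verts h here        = h _ ∷ []
  mapWalk-verts h (there a w) = h _ ∷ mapWalk-verts h w

infixl 5 _▷_
_▷_ : ∀ {V : Set} {E : V → V → Set} {x y z} → Walk E x y → E y z → Walk E x z
here      ▷ b = there b here
there a w ▷ b = there a (w ▷ b)

-- "exactly one of T b and T a" is T (a xor b); this is the shape of the
-- adjacency relation of H
xor⇔ : ∀ a b → ((T b × ¬ T a) ⊎ (¬ T b × T a)) ⇔ T (a xor b)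
xor⇔ a b = mk⇔ (to a b) (from a b)
  where
  to : ∀ a b → ((T b × ¬ T a) ⊎ (¬ T b × T a)) → T (a xor b)
  to true  true  (inj₁ (_ , ¬a)) = ¬a tt
  to true  true  (inj₂ (¬b , _)) = ¬b tt
  to true  false _               = tt
  to false true  _               = tt
  to false false (inj₁ (() , _))
  to false false (inj₂ (_ , ()))
  from : ∀ a b → T (a xor b) → ((T b × ¬ T a) ⊎ (¬ T b × T a))
  from true  false _ = inj₂ ((λ ()) , tt)
  from false true  _ = inj₁ (tt , (λ ()))

splitAt-injective : ∀ m {n} {x y : Fin (m + n)} → splitAt m x ≡ splitAt m y → x ≡ y
splitAt-injective m {n} {x} {y} eq =
  trans (sym (join-splitAt m n x)) (trans (cong (join m n) eq) (join-splitAt m n y))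

map₂-injective : ∀ {A B C : Set} {g : B → C} → (∀ {a b} → g a ≡ g b → a ≡ b) →
                 ∀ {u v : A ⊎ B} → map₂ g u ≡ map₂ g v → u ≡ v
map₂-injective g-inj {inj₁ a} {inj₁ a'} eq = cong inj₁ (inj₁-injective eq)
map₂-injective g-inj {inj₂ b} {inj₂ b'} eq = cong inj₂ (g-inj (inj₂-injective eq))
map₂-injective g-inj {inj₁ a} {inj₂ b} ()
map₂-injective g-inj {inj₂ b} {inj₁ a} ()

graph-· : ∀ {k} (σ τ : Deriv k) → IsGraph σ → IsGraph τ → IsGraph (σ · τ)
graph-· σ τ (σ-sym , σ-irr) (τ-sym , τ-irr) = symmetric , irreflexive
  where
  symmetric : ∀ x y → compAdj σ τ x y ≡ compAdj σ τ y x
  symmetric x y with splitAt (size σ) x | splitAt (size σ) y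
  ... | inj₁ u | inj₁ u' = σ-sym u u'
  ... | inj₂ v | inj₂ v' = τ-sym v v'
  ... | inj₁ u | inj₂ v  = refl
  ... | inj₂ v | inj₁ u  = refl
  irreflexive : ∀ x → compAdj σ τ x x ≡ false
  irreflexive x with splitAt (size σ) x
  ... | inj₁ u = σ-irr u
  ... | inj₂ v = τ-irr v

-- σ₀·(σ₁·(⋯·σₙ)) without the trailing neutral element ε; unlike prod it is
-- built from the σ_s alone, so it inherits every property closed under ·
prod⁺ : ∀ {k} n → (Fin (suc n) → Deriv k) → Deriv k
prod⁺ zero    σ = σ zero
prod⁺ (suc n) σ = σ zero · prod⁺ n (σ ∘ suc)

graph-prod⁺ : ∀ {k} n (σ : Fin (suc n) → Deriv k) → (∀ s → IsGraph (σ s)) → IsGraph (prod⁺ n σ)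
graph-prod⁺ zero    σ graphs = graphs zero
graph-prod⁺ (suc n) σ graphs =
  graph-· (σ zero) (prod⁺ n (σ ∘ suc)) (graphs zero) (graph-prod⁺ n (σ ∘ suc) (graphs ∘ suc))

toProd⁺ : ∀ {k} n (σ : Fin (suc n) → Deriv k) → Fin (size (prod (suc n) σ)) → Fin (size (prod⁺ n σ))
toProd⁺ zero    σ x with splitAt (size (σ zero)) x
... | inj₁ u = u
... | inj₂ ()
toProd⁺ (suc n) σ x with splitAt (size (σ zero)) x
... | inj₁ u = u ↑ˡ size (prod⁺ n (σ ∘ suc))
... | inj₂ v = size (σ zero) ↑ʳ toProd⁺ n (σ ∘ suc) v

-- prod⁺ and prod have the same recolouring, so toProd⁺ preserves cells and
-- adjacency exactly
rec-prod⁺ : ∀ {k} n (σ : Fin (suc n) → Deriv k) i → rec (prod⁺ n σ) i ≡ rec (prod (suc n) σ) i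
rec-prod⁺ zero    σ i = refl
rec-prod⁺ (suc n) σ i = rec-prod⁺ n (σ ∘ suc) (rec (σ zero) i)

cell-toProd⁺ : ∀ {k} n (σ : Fin (suc n) → Deriv k) x →
               cellOf (prod⁺ n σ) (toProd⁺ n σ x) ≡ cellOf (prod (suc n) σ) x
cell-toProd⁺ zero σ x with splitAt (size (σ zero)) x
... | inj₁ u = refl
... | inj₂ ()
cell-toProd⁺ (suc n) σ x with splitAt (size (σ zero)) x
... | inj₁ u rewrite splitAt-↑ˡ (size (σ zero)) u (size (prod⁺ n (σ ∘ suc))) =
  cong (_, prof (σ zero) u) (rec-prod⁺ n (σ ∘ suc) (col (σ zero) u))
... | inj₂ v rewrite splitAt-↑ʳ (size (σ zero)) (size (prod⁺ n (σ ∘ suc))) (toProd⁺ n (σ ∘ suc) v) =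
  cell-toProd⁺ n (σ ∘ suc) v

adj-toProd⁺ : ∀ {k} n (σ : Fin (suc n) → Deriv k) x y →
              adj (prod⁺ n σ) (toProd⁺ n σ x) (toProd⁺ n σ y) ≡ adj (prod (suc n) σ) x y
adj-toProd⁺ zero σ x y with splitAt (size (σ zero)) x | splitAt (size (σ zero)) y
... | inj₁ u  | inj₁ u' = refl
... | inj₂ () | _
... | inj₁ u  | inj₂ ()
adj-toProd⁺ (suc n) σ x y with splitAt (size (σ zero)) x | splitAt (size (σ zero)) y
... | inj₁ u | inj₁ u'
  rewrite splitAt-↑ˡ (size (σ zero)) u (size (prod⁺ n (σ ∘ suc)))
        | splitAt-↑ˡ (size (σ zero)) u' (size (prod⁺ n (σ ∘ suc))) = refl
... | inj₂ v | inj₂ v'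
  rewrite splitAt-↑ʳ (size (σ zero)) (size (prod⁺ n (σ ∘ suc))) (toProd⁺ n (σ ∘ suc) v)
        | splitAt-↑ʳ (size (σ zero)) (size (prod⁺ n (σ ∘ suc))) (toProd⁺ n (σ ∘ suc) v') =
  adj-toProd⁺ n (σ ∘ suc) v v'
... | inj₁ u | inj₂ v
  rewrite splitAt-↑ˡ (size (σ zero)) u (size (prod⁺ n (σ ∘ suc)))
        | splitAt-↑ʳ (size (σ zero)) (size (prod⁺ n (σ ∘ suc))) (toProd⁺ n (σ ∘ suc) v) =
  cong₂ lookup (cong proj₂ (cell-toProd⁺ n (σ ∘ suc) v)) (rec-prod⁺ n (σ ∘ suc) (col (σ zero) u))
... | inj₂ v | inj₁ u
  rewrite splitAt-↑ˡ (size (σ zero)) u (size (prod⁺ n (σ ∘ suc)))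
        | splitAt-↑ʳ (size (σ zero)) (size (prod⁺ n (σ ∘ suc))) (toProd⁺ n (σ ∘ suc) v) =
  cong₂ lookup (cong proj₂ (cell-toProd⁺ n (σ ∘ suc) v)) (rec-prod⁺ n (σ ∘ suc) (col (σ zero) u))

-- toProd⁺ commutes with splitting off the first block, hence is injective
splitAt-toProd⁺ : ∀ {k} n (σ : Fin (suc (suc n)) → Deriv k) x →
                  splitAt (size (σ zero)) (toProd⁺ (suc n) σ x)
                    ≡ map₂ (toProd⁺ n (σ ∘ suc)) (splitAt (size (σ zero)) x)
splitAt-toProd⁺ n σ x with splitAt (size (σ zero)) x
... | inj₁ u = splitAt-↑ˡ (size (σ zero)) u (size (prod⁺ n (σ ∘ suc)))
... | inj₂ v = splitAt-↑ʳ (size (σ zero)) (size (prod⁺ n (σ ∘ suc))) (toProd⁺ n (σ ∘ suc) v)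

splitAt-toProd⁺₀ : ∀ {k} (σ : Fin 1 → Deriv k) x →
                   splitAt (size (σ zero)) x ≡ inj₁ (toProd⁺ zero σ x)
splitAt-toProd⁺₀ σ x with splitAt (size (σ zero)) x
... | inj₁ u = refl
... | inj₂ ()

toProd⁺-injective : ∀ {k} n (σ : Fin (suc n) → Deriv k) {x y} →
                    toProd⁺ n σ x ≡ toProd⁺ n σ y → x ≡ y
toProd⁺-injective zero σ {x} {y} eq = splitAt-injective (size (σ zero)) (begin
  splitAt (size (σ zero)) x     ≡⟨ splitAt-toProd⁺₀ σ x ⟩
  inj₁ (toProd⁺ zero σ x)       ≡⟨ cong inj₁ eq ⟩
  inj₁ (toProd⁺ zero σ y)       ≡⟨ splitAt-toProd⁺₀ σ y ⟨
  splitAt (size (σ zero)) y     ∎)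
  where open ≡-Reasoning
toProd⁺-injective (suc n) σ {x} {y} eq =
  splitAt-injective (size (σ zero)) (map₂-injective (toProd⁺-injective n (σ ∘ suc)) (begin
    map₂ (toProd⁺ n (σ ∘ suc)) (splitAt (size (σ zero)) x)  ≡⟨ splitAt-toProd⁺ n σ x ⟨
    splitAt (size (σ zero)) (toProd⁺ (suc n) σ x)           ≡⟨ cong (splitAt (size (σ zero))) eq ⟩
    splitAt (size (σ zero)) (toProd⁺ (suc n) σ y)           ≡⟨ splitAt-toProd⁺ n σ y ⟩
    map₂ (toProd⁺ n (σ ∘ suc)) (splitAt (size (σ zero)) y)  ∎))
  where open ≡-Reasoning

inject : ∀ {k} n (σ : Fin n → Deriv k) (s : Fin n) → Fin (size (σ s)) → Fin (size (prod n σ))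
inject (suc n) σ zero    u = u ↑ˡ size (prod n (σ ∘ suc))
inject (suc n) σ (suc s) v = size (σ zero) ↑ʳ inject n (σ ∘ suc) s v

inject-injective : ∀ {k} n (σ : Fin n → Deriv k) s {u v} → inject n σ s u ≡ inject n σ s v → u ≡ v
inject-injective (suc n) σ zero    eq = ↑ˡ-injective _ _ _ eq
inject-injective (suc n) σ (suc s) eq = inject-injective n (σ ∘ suc) s (↑ʳ-injective _ _ _ eq)

blockOf-inject : ∀ {k} n (σ : Fin n → Deriv k) s u → blockOf n σ (inject n σ s u) ≡ s
blockOf-inject (suc n) σ zero u rewrite splitAt-↑ˡ (size (σ zero)) u (size (prod n (σ ∘ suc))) = refl
blockOf-inject (suc n) σ (suc s) v
  rewrite splitAt-↑ʳ (size (σ zero)) (size (prod n (σ ∘ suc))) (inject n (σ ∘ suc) s v) =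
  cong suc (blockOf-inject n (σ ∘ suc) s v)

localCell-inject : ∀ {k} n (σ : Fin n → Deriv k) s u → localCell n σ (inject n σ s u) ≡ cellOf (σ s) u
localCell-inject (suc n) σ zero u rewrite splitAt-↑ˡ (size (σ zero)) u (size (prod n (σ ∘ suc))) = refl
localCell-inject (suc n) σ (suc s) v
  rewrite splitAt-↑ʳ (size (σ zero)) (size (prod n (σ ∘ suc))) (inject n (σ ∘ suc) s v) =
  localCell-inject n (σ ∘ suc) s v

adj-inject : ∀ {k} n (σ : Fin n → Deriv k) s u v →
             adj (prod n σ) (inject n σ s u) (inject n σ s v) ≡ adj (σ s) u v
adj-inject (suc n) σ zero u v
  rewrite splitAt-↑ˡ (size (σ zero)) u (size (prod n (σ ∘ suc)))
        | splitAt-↑ˡ (size (σ zero)) v (size (prod n (σ ∘ suc))) = refl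
adj-inject (suc n) σ (suc s) u v
  rewrite splitAt-↑ʳ (size (σ zero)) (size (prod n (σ ∘ suc))) (inject n (σ ∘ suc) s u)
        | splitAt-↑ʳ (size (σ zero)) (size (prod n (σ ∘ suc))) (inject n (σ ∘ suc) s v) =
  adj-inject n (σ ∘ suc) s u v

module WithAbstraction {k : ℕ} (e : Abstraction k) where

  -- two cells are equivalent if they have the same profile and φ-equal
  -- colours; everything defined through `sees` is invariant under ∼
  _∼_ : Cell k → Cell k → Set
  c ∼ d = proj₂ c ≡ proj₂ d × φ e (proj₁ c) ≡ φ e (proj₁ d)

  ∼-refl : ∀ {c} → c ∼ c
  ∼-refl = refl , refl

  ∼-sym : ∀ {c d} → c ∼ d → d ∼ c
  ∼-sym (X≡Y , φi≡φj) = sym X≡Y , sym φi≡φj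

  ∼-trans : ∀ {c d b} → c ∼ d → d ∼ b → c ∼ b
  ∼-trans (X≡Y , φi≡φj) (Y≡Z , φj≡φl) = trans X≡Y Y≡Z , trans φi≡φj φj≡φl

  sees-resp : ∀ {c c' d d'} → c ∼ c' → d ∼ d' → sees e c d ≡ sees e c' d'
  sees-resp (X≡X' , _) (_ , φj≡φj') = cong₂ lookup X≡X' φj≡φj'

  positive : Cell k → Cell k → Bool
  positive c d = sees e c d ∧ sees e d c

  positive-resp : ∀ {c c' d d'} → c ∼ c' → d ∼ d' → positive c d ≡ positive c' d'
  positive-resp c∼c' d∼d' = cong₂ _∧_ (sees-resp c∼c' d∼d') (sees-resp d∼d' c∼c')

  -- positivity is symmetric, so flipping along the pairs of Z is flipping along positive pairs
  positive-symmetrised : ∀ c d → (positive c d ∨ positive d c) ≡ positive c d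
  positive-symmetrised c d =
    trans (cong (positive c d ∨_) (∧-comm (sees e d c) (sees e c d))) (∨-idem (positive c d))

  Mixed-resp : ∀ {c c' d d'} → c ∼ c' → d ∼ d' → Mixed e c d → Mixed e c' d'
  Mixed-resp c∼c' d∼d' = subst T (cong₂ _xor_ (sees-resp c∼c' d∼d') (sees-resp d∼d' c∼c'))

  Mixed-sym : ∀ {c d} → Mixed e c d → Mixed e d c
  Mixed-sym {c} {d} = subst T (xor-comm (sees e c d) (sees e d c))

  InComponent : Cell k → Cell k → Set
  InComponent c₀ c = Social e c × SameComponent e c₀ c

  -- an essential cell equivalent to a cell of the component of c₀ lies in
  -- that component: both are mixed with the same essential cell d
  InComponent-resp : ∀ {c₀ c c'} → c ∼ c' → Essential e c' → InComponent c₀ c → InComponent c₀ c'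
  InComponent-resp {c₀} {c} {c'} c∼c' ess' (social@(ess , d , ess-d , mixed-cd) , c₀⇝c) =
    social' , (c₀⇝c ▷ (social , social-d , mixed-cd) ▷ (social-d , social' , Mixed-sym {c'} {d} mixed-c'd))
    where
    mixed-c'd : Mixed e c' d
    mixed-c'd = Mixed-resp {c} {c'} {d} {d} c∼c' ∼-refl mixed-cd
    social' : Social e c'
    social' = ess' , d , ess-d , mixed-c'd
    social-d : Social e d
    social-d = ess-d , c , ess , Mixed-sym {c} {d} mixed-cd

  -- the set W: cells forming no mixed pair with a cell occupied in σ;
  -- it is a Boolean predicate because σ is finite
  unmixedIn : Deriv k → Cell k → Bool
  unmixedIn σ c = ⌊ ¬? (any? (λ w → T? (sees e c (cellOf σ w) xor sees e (cellOf σ w) c))) ⌋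

  unmixedIn-resp : ∀ {σ c c'} → c ∼ c' → T (unmixedIn σ c) → T (unmixedIn σ c')
  unmixedIn-resp {σ} {c} {c'} c∼c' unmixed =
    fromWitness λ (w , mixed) →
      toWitness unmixed (w , Mixed-resp {c'} {c} {cellOf σ w} (∼-sym {c} c∼c') ∼-refl mixed)

  -- if σ has abstraction e, the occupied cells of σ are the essential ones,
  -- so W consists exactly of the cells that are not mixed with an essential cell
  solitary⇒unmixedIn : ∀ {σ c} → HasAbstraction σ e → Solitary e c → T (unmixedIn σ c)
  solitary⇒unmixedIn {σ} (cells , _) (_ , no-mixed) =
    fromWitness λ (w , mixed) →
      no-mixed (cellOf σ w , Equivalence.from (cells (cellOf σ w)) (w , refl) , mixed)

  unmixedIn⇒solitary : ∀ {σ c} → HasAbstraction σ e → Essential e c → T (unmixedIn σ c) → Solitary e c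
  unmixedIn⇒solitary {σ} {c} (cells , _) ess unmixed = ess , no-mixed
    where
    no-mixed : ¬ (Σ (Cell k) λ d → Essential e d × Mixed e c d)
    no-mixed (d , ess-d , mixed) with Equivalence.to (cells d) ess-d
    ... | w , cell-w≡d = toWitness unmixed (w , subst (Mixed e c) (sym cell-w≡d) mixed)

  PosFlip : (σ : Deriv k) → Fin (size σ) → Fin (size σ) → Set
  PosFlip σ = ZFlipAdj σ positive

  record _↪_ (σ τ : Deriv k) : Set where
    field
      embed           : Fin (size σ) → Fin (size τ)
      embed-injective : ∀ {u v} → embed u ≡ embed v → u ≡ v
      adj-embed       : ∀ u v → adj τ (embed u) (embed v) ≡ adj σ u v
      cell-embed      : ∀ u → cellOf σ u ∼ cellOf τ (embed u)
  open _↪_ public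

  posFlip-embed : ∀ {σ τ} (ι : σ ↪ τ) {u v} → PosFlip σ u v → PosFlip τ (embed ι u) (embed ι v)
  posFlip-embed {σ} {τ} ι {u} {v} =
    subst T (cong₂ _xor_ (sym (adj-embed ι u v))
                         (cong₂ _∨_ (positive-resp (cell-embed ι u) (cell-embed ι v))
                                    (positive-resp (cell-embed ι v) (cell-embed ι u))))

  φ-idempotent : ∀ {σ} → IsGraph σ → HasAbstraction σ e → Idempotent e → ∀ i → φ e (φ e i) ≡ φ e i
  φ-idempotent {σ} graph abstr idem i = begin
    φ e (φ e i)       ≡⟨ rec≡φ (φ e i) ⟩
    rec σ (φ e i)     ≡⟨ cong (rec σ) (rec≡φ i) ⟩
    rec σ (rec σ i)   ≡⟨ proj₂ (proj₂ (idem σ σ graph graph abstr abstr)) i ⟨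
    φ e i             ∎
    where
    open ≡-Reasoning
    rec≡φ : ∀ j → φ e j ≡ rec σ j
    rec≡φ = proj₂ (proj₂ abstr)

  -- a product of derivations with abstraction e again has abstraction e
  -- (as long as it is nonempty, i.e. written with prod⁺)
  abstraction-prod⁺ : Idempotent e → ∀ n (σ : Fin (suc n) → Deriv k) →
    (∀ s → IsGraph (σ s)) → (∀ s → HasAbstraction (σ s) e) → HasAbstraction (prod⁺ n σ) e
  abstraction-prod⁺ idem zero    σ graphs abstr = abstr zero
  abstraction-prod⁺ idem (suc n) σ graphs abstr =
    idem (σ zero) (prod⁺ n (σ ∘ suc)) (graphs zero) (graph-prod⁺ n (σ ∘ suc) (graphs ∘ suc))
         (abstr zero) (abstraction-prod⁺ idem n (σ ∘ suc) (graphs ∘ suc) (abstr ∘ suc))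

  prod↪prod⁺ : ∀ n (σ : Fin (suc n) → Deriv k) → prod (suc n) σ ↪ prod⁺ n σ
  prod↪prod⁺ n σ = record
    { embed           = toProd⁺ n σ
    ; embed-injective = toProd⁺-injective n σ
    ; adj-embed       = adj-toProd⁺ n σ
    ; cell-embed      = λ x → subst (cellOf (prod (suc n) σ) x ∼_) (sym (cell-toProd⁺ n σ x)) ∼-refl
    }

  module Product (φ-idem : ∀ i → φ e (φ e i) ≡ φ e i) where

    φ-rec-prod : ∀ n (σ : Fin n → Deriv k) → (∀ s → HasAbstraction (σ s) e) →
                 ∀ i → φ e (rec (prod n σ) i) ≡ φ e i
    φ-rec-prod zero    σ abstr i = refl
    φ-rec-prod (suc n) σ abstr i = begin
      φ e (rec (prod n (σ ∘ suc)) (rec (σ zero) i))  ≡⟨ φ-rec-prod n (σ ∘ suc) (abstr ∘ suc) (rec (σ zero) i) ⟩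
      φ e (rec (σ zero) i)                           ≡⟨ cong (φ e) (proj₂ (proj₂ (abstr zero)) i) ⟨
      φ e (φ e i)                                    ≡⟨ φ-idem i ⟩
      φ e i                                          ∎
      where open ≡-Reasoning

    local∼global : ∀ n (σ : Fin n → Deriv k) → (∀ s → HasAbstraction (σ s) e) →
                   ∀ x → localCell n σ x ∼ cellOf (prod n σ) x
    local∼global (suc n) σ abstr x with splitAt (size (σ zero)) x
    ... | inj₁ u = refl , sym (φ-rec-prod n (σ ∘ suc) (abstr ∘ suc) (col (σ zero) u))
    ... | inj₂ v = local∼global n (σ ∘ suc) (abstr ∘ suc) v

    localCell-essential : ∀ n (σ : Fin n → Deriv k) → (∀ s → HasAbstraction (σ s) e) →
                          ∀ x → Essential e (localCell n σ x)
    localCell-essential (suc n) σ abstr x with splitAt (size (σ zero)) x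
    ... | inj₁ u = Equivalence.from (proj₁ (abstr zero) (cellOf (σ zero) u)) (u , refl)
    ... | inj₂ v = localCell-essential n (σ ∘ suc) (abstr ∘ suc) v

    H⇔posFlip : ∀ n (σ : Fin n → Deriv k) → (∀ s → HasAbstraction (σ s) e) →
                ∀ {x y} → HAdj e n σ x y ⇔ PosFlip (prod n σ) x y
    H⇔posFlip n σ abstr {x} {y} = mk⇔
      (subst (λ b → T (a xor b)) flip-bit ∘ Equivalence.to (xor⇔ a pos) ∘ H⇒)
      (⇒H ∘ Equivalence.from (xor⇔ a pos) ∘ subst (λ b → T (a xor b)) (sym flip-bit))
      where
      a : Bool
      a = adj (prod n σ) x y
      lc pc : Fin (size (prod n σ)) → Cell k
      lc = localCell n σ
      pc = cellOf (prod n σ)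
      pos : Bool
      pos = positive (lc x) (lc y)
      ess : ∀ z → Essential e (lc z)
      ess = localCell-essential n σ abstr
      flip-bit : pos ≡ (positive (pc x) (pc y) ∨ positive (pc y) (pc x))
      flip-bit = trans (positive-resp (local∼global n σ abstr x) (local∼global n σ abstr y))
                       (sym (positive-symmetrised (pc x) (pc y)))
      -- a pair flipped in H is just a positive pair, all cells being essential
      H⇒ : HAdj e n σ x y → (T pos × ¬ T a) ⊎ (¬ T pos × T a)
      H⇒ (inj₁ ((_ , _ , positive-xy) , ¬adj)) = inj₁ (positive-xy , ¬adj)
      H⇒ (inj₂ (¬flip , adj-xy))               = inj₂ ((λ positive-xy → ¬flip (ess x , ess y , positive-xy)) , adj-xy)
      ⇒H : (T pos × ¬ T a) ⊎ (¬ T pos × T a) → HAdj e n σ x y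
      ⇒H (inj₁ (positive-xy , ¬adj))  = inj₁ ((ess x , ess y , positive-xy) , ¬adj)
      ⇒H (inj₂ (¬positive , adj-xy))  = inj₂ ((λ (_ , _ , positive-xy) → ¬positive positive-xy) , adj-xy)

    block↪prod : ∀ n (σ : Fin n → Deriv k) → (∀ s → HasAbstraction (σ s) e) → ∀ s → σ s ↪ prod n σ
    block↪prod n σ abstr s = record
      { embed           = inject n σ s
      ; embed-injective = inject-injective n σ s
      ; adj-embed       = adj-inject n σ s
      ; cell-embed      = λ u → subst (_∼ cellOf (prod n σ) (inject n σ s u))
                                      (localCell-inject n σ s u) (local∼global n σ abstr (inject n σ s u))
      }

module Setting {k n : ℕ} (σ : Fin (suc n) → Deriv k) (e : Abstraction k)
               (graphs : ∀ s → IsGraph (σ s)) (abstr : ∀ s → HasAbstraction (σ s) e)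
               (idem : Idempotent e) where

  open WithAbstraction e
  open Product (φ-idempotent (graphs zero) (abstr zero) idem)

  lc : Fin (size (prod (suc n) σ)) → Cell k
  lc = localCell (suc n) σ

  solitaryPath⇒ρ : ∀ s {x y} (p : Walk (HAdj e (suc n) σ) x y) → SolitaryPath e (suc n) σ p →
    Σ (Cell k) λ c → Σ (Cell k) λ d →
      _∼_ (lc x) c × _∼_ (lc y) d × ¬ Mixed e c d × ρ e (positive) c d (unmixedIn (σ s))
  solitaryPath⇒ρ s {x} {y} p (p-path , p-solitary , not-mixed) =
    cellOf Q (f x) , cellOf Q (f y) , lc∼ x , lc∼ y ,
    not-mixed ∘ Mixed-resp (∼-sym (lc∼ x)) (∼-sym (lc∼ y)) ,
    Equivalence.from (proj₁ (proj₂ abstr-Q) _ _ _ _)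
      (f x , f y , refl , refl , pQ ,
       mapWalk-isPath f toQ (embed-injective ι) p-path ,
       mapWalk-inner f toQ solitary⇒W p p-solitary)
    where
    Q : Deriv k
    Q = prod⁺ n σ
    abstr-Q : HasAbstraction Q e
    abstr-Q = abstraction-prod⁺ idem n σ graphs abstr
    ι : prod (suc n) σ ↪ Q
    ι = prod↪prod⁺ n σ
    f : Fin (size (prod (suc n) σ)) → Fin (size Q)
    f = embed ι
    lc∼ : ∀ z → _∼_ (lc z) (cellOf Q (f z))
    lc∼ z = ∼-trans (local∼global (suc n) σ abstr z) (cell-embed ι z)
    toQ : ∀ {u v} → HAdj e (suc n) σ u v → PosFlip Q (f u) (f v)
    toQ = posFlip-embed ι ∘ Equivalence.to (H⇔posFlip (suc n) σ abstr)
    pQ : Walk (PosFlip Q) (f x) (f y)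
    pQ = mapWalk f toQ p
    solitary⇒W : ∀ {v} → SolitaryVertex e (suc n) σ v → T (unmixedIn (σ s) (cellOf Q (f v)))
    solitary⇒W {v} = unmixedIn-resp {σ s} (lc∼ v) ∘ solitary⇒unmixedIn {σ s} (abstr s)

  ρ⇒blockPath : ∀ s {c d} → ρ e (positive) c d (unmixedIn (σ s)) → ¬ Mixed e c d →
    Σ (Fin (size (prod (suc n) σ))) λ x' → Σ (Fin (size (prod (suc n) σ))) λ y' →
      lc x' ≡ c × lc y' ≡ d ×
      Σ (Walk (HAdj e (suc n) σ) x' y') λ q →
        SolitaryPath e (suc n) σ q × All (λ v → blockOf (suc n) σ v ≡ s) (verts (HAdj e (suc n) σ) q)
  ρ⇒blockPath s {c} {d} ρcd not-mixed
    with Equivalence.to (proj₁ (proj₂ (abstr s)) _ _ _ _) ρcd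
  ... | u , v , cell-u , cell-v , q , q-path , q-inner =
    g u , g v , x'∈c , y'∈d , mapWalk g toH q ,
    (mapWalk-isPath g toH (embed-injective ι) q-path ,
     mapWalk-inner g toH W⇒solitary q q-inner ,
     not-mixed ∘ subst₂ (Mixed e) x'∈c y'∈d) ,
    mapWalk-verts g toH (blockOf-inject (suc n) σ s) q
    where
    ι : σ s ↪ prod (suc n) σ
    ι = block↪prod (suc n) σ abstr s
    g : Fin (size (σ s)) → Fin (size (prod (suc n) σ))
    g = embed ι
    x'∈c : lc (g u) ≡ c
    x'∈c = trans (localCell-inject (suc n) σ s u) cell-u
    y'∈d : lc (g v) ≡ d
    y'∈d = trans (localCell-inject (suc n) σ s v) cell-v
    toH : ∀ {w w'} → PosFlip (σ s) w w' → HAdj e (suc n) σ (g w) (g w')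
    toH = Equivalence.from (H⇔posFlip (suc n) σ abstr) ∘ posFlip-embed ι
    W⇒solitary : ∀ {w} → T (unmixedIn (σ s) (cellOf (σ s) w)) → SolitaryVertex e (suc n) σ (g w)
    W⇒solitary {w} =
      subst (Solitary e) (sym (localCell-inject (suc n) σ s w))
      ∘ unmixedIn⇒solitary {σ s} (abstr s) (Equivalence.from (proj₁ (abstr s) _) (w , refl))

  InUComp-transfer : ∀ {c₀ c x x'} → _∼_ (lc x) c → lc x' ≡ c →
                     InUComp e (suc n) σ c₀ x → InUComp e (suc n) σ c₀ x'
  InUComp-transfer {x = x} {x'} x∼c x'∈c =
    InComponent-resp (subst (_∼_ (lc x)) (sym x'∈c) x∼c) (localCell-essential (suc n) σ abstr x')

mainTheorem16 : ∀ (k n : ℕ) (σ : Fin n → Deriv k) (e : Abstraction k) →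
    (∀ s → IsGraph (σ s)) →
    (∀ s → HasAbstraction (σ s) e) →
    Idempotent e →
    ∀ (c₀ d₀ : Cell k) → Social e c₀ → Social e d₀ → ¬ SameComponent e c₀ d₀ →
    (Σ (Fin (size (prod n σ))) λ x → Σ (Fin (size (prod n σ))) λ y →
      InUComp e n σ c₀ x × InUComp e n σ d₀ y ×
      Σ (Walk (HAdj e n σ) x y) λ p → SolitaryPath e n σ p) →
    ∀ (s : Fin n) →
      Σ (Fin (size (prod n σ))) λ x → Σ (Fin (size (prod n σ))) λ y →
        InUComp e n σ c₀ x × InUComp e n σ d₀ y ×
        Σ (Walk (HAdj e n σ) x y) λ p →
          SolitaryPath e n σ p × All (λ v → blockOf n σ v ≡ s) (verts (HAdj e n σ) p)
mainTheorem16 k zero σ e graphs abstr idem c₀ d₀ _ _ _ _ ()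
mainTheorem16 k (suc n) σ e graphs abstr idem c₀ d₀ _ _ _ (x , y , x∈C , y∈D , p , p-solitary) s =
  let open Setting σ e graphs abstr idem
      (c , d , x∼c , y∼d , not-mixed , ρcd) = solitaryPath⇒ρ s p p-solitary
      (x' , y' , x'∈c , y'∈d , q , q-solitary , q-in-block) = ρ⇒blockPath s ρcd not-mixed
  in x' , y' , InUComp-transfer x∼c x'∈c x∈C , InUComp-transfer y∼d y'∈d y∈D ,
     q , q-solitary , q-in-block
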